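{- Let $k\ge4$, $2\le m\le\infty$, $q:=\lceil k/m\rceil$ (with $\lceil k/\infty\rceil:=1$), and $n\ge k+q$. If $\mathcal{B}\subseteq\mathcal{P}$ is maximal intersecting with respect to $\mathcal{P}$ and $\bigcap\mathcal{B}^\star=\emptyset$, then $(\mathcal{U}\setminus\mathcal{B})(n-k)\neq\emptyset$.
   Context: $[n]=\{1,\dots,n\}$; $\mathcal{P}$ is the family of nonempty proper subsets of $[n]$. For $\mathcal{B}\subseteq\mathcal{P}$, $\mathcal{B}(i)=\{B\in\mathcal{B}:|B|=i\}$ and $\mathcal{B}^\star=\bigcup_{i=q}^{k}\mathcal{B}(i)$; $\bigcap\mathcal{B}^\star$ denotes the intersection of all members of $\mathcal{B}^\star$, with the convention that the intersection of the empty family is nonempty. $\mathcal{U}=\{B\in\mathcal{P}:1\in B\}$. A family $\mathcal{B}\subseteq\mathcal{P}$ is intersecting if any two members intersect, and maximal intersecting with respect to $\mathcal{P}$ if it is intersecting and every $Y\in\mathcal{P}\setminus\mathcal{B}$ is disjoint from some member of $\mathcal{B}$. -}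

module Defs where

open import Data.Nat using (ℕ; zero; suc; _+_; _≤_; _<_)
open import Data.Nat.DivMod using (_/_)
open import Data.Maybe using (Maybe; just; nothing)
open import Data.Unit using (⊤)
open import Data.Empty using (⊥)
open import Data.Bool using (T)
open import Data.Vec using (_∷_; [])
open import Data.Fin using (Fin)
open import Data.Fin.Subset using (Subset; _∈_; _∉_; _∩_; Nonempty; Empty; ∣_∣)
open import Data.Product using (Σ; ∃; _×_; _,_)
open import Relation.Nullary using (¬_)
open import Level using (0ℓ)
open import Relation.Unary using (Pred)

-- m ∈ {2,3,…} ∪ {∞}: `just m` is finite m, `nothing` is ∞.
ℕ∞ : Set
ℕ∞ = Maybe ℕ

ValidM : ℕ∞ → Set
ValidM (just m) = 2 ≤ m
ValidM nothing  = ⊤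

-- ceiling division ⌈k/m⌉ (m ≥ 1); ⌈k/0⌉ is an unused junk value 0
⌈_/_⌉ : ℕ → ℕ → ℕ
⌈ k / zero ⌉  = 0
⌈ k / suc m ⌉ = (k + m) / suc m

qOf : ℕ → ℕ∞ → ℕ
qOf k (just m) = ⌈ k / m ⌉
qOf k nothing  = 1

Family : ℕ → Set₁
Family n = Pred (Subset n) 0ℓ

InP : ∀ {n} → Subset n → Set
InP Y = Nonempty Y × (∃ λ x → x ∉ Y)

-- 𝒰 : members of 𝒫 containing the element 1 (= the first coordinate of [n])
Contains1 : ∀ {n} → Subset n → Set
Contains1 []      = ⊥
Contains1 (b ∷ _) = T b

InU : ∀ {n} → Subset n → Set
InU Y = InP Y × Contains1 Y

Intersecting : ∀ {n} → Family n → Set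
Intersecting B = ∀ X Y → B X → B Y → Nonempty (X ∩ Y)

MaximalIntersecting : ∀ {n} → Family n → Set
MaximalIntersecting B =
  (∀ X → B X → InP X) ×
  Intersecting B ×
  (∀ Y → InP Y → ¬ B Y → ∃ λ X → B X × Empty (X ∩ Y))

-- membership in ℬ⋆ = ⋃_{i=q}^{k} ℬ(i)
InStar : ∀ {n} → ℕ → ℕ → Family n → Subset n → Set
InStar q k B X = B X × q ≤ ∣ X ∣ × ∣ X ∣ ≤ k

-- ⋂ ℬ⋆ = ∅ : no element of [n] lies in every member of ℬ⋆
-- (the empty family has nonempty intersection, consistent with this)
StarIntersectionEmpty : ∀ {n} → ℕ → ℕ → Family n → Set
StarIntersectionEmpty {n} q k B = ¬ (∃ λ (x : Fin n) → ∀ X → InStar q k B X → x ∈ X)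

{-# OPTIONS --safe #-}
-- Since ⋂ℬ⋆ = ∅ and ℬ is decidable, some Z ∈ ℬ⋆ misses the element 1. Its
-- complement contains 1 and has at least n − k ≥ q ≥ 1 elements, so it has a
-- subset Y ∋ 1 of size exactly n − k. Y is disjoint from Z ∈ ℬ, hence not in the
-- intersecting family ℬ, and Y is proper because it misses the nonempty Z.
module Submission where

open import Defs
open import Data.Nat using (ℕ; zero; suc; _+_; _∸_; _≤_; _<_; z≤n; s≤s; _≤?_)
open import Data.Nat.Properties using (≤-trans; +-comm; +-monoˡ-≤; +-monoʳ-≤; ∸-monoʳ-≤; m<n⇒0<n∸m)
open import Data.Nat.DivMod using (m≥n⇒m/n>0)
open import Data.Fin using (Fin)
import Data.Fin as Fin
open import Data.Fin.Subset using (Subset; ∣_∣; _∈_; _∉_; _⊆_; ∁; inside; outside; Nonempty)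
open import Data.Fin.Subset.Properties using (anySubset?; _∈?_; ∣∁p∣≡n∸∣p∣; x∈p∩q⁻; x∈∁p⇒x∉p; x∉p⇒x∈∁p)
open import Data.Vec using (_∷_; []; here; there)
open import Data.Bool using (true; false)
open import Data.Unit using (tt)
open import Data.Maybe using (just; nothing)
open import Data.Product using (∃; _×_; _,_)
open import Relation.Nullary using (¬_; yes; no; contradiction)
open import Relation.Nullary.Decidable using (_×-dec_; ¬?)
open import Relation.Unary using (Decidable)
open import Relation.Binary.PropositionalEquality using (_≡_; refl; sym; cong; subst)

qOf-positive : ∀ {k} m → 1 ≤ k → ValidM m → 1 ≤ qOf k m
qOf-positive nothing         _   _ = s≤s z≤n
qOf-positive (just (suc m))  1≤k _ = m≥n⇒m/n>0 (+-monoˡ-≤ m 1≤k)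

∃-member-∉ : ∀ {n} {P : Family n} → Decidable P → (x : Fin n) →
             ¬ (∀ X → P X → x ∈ X) → ∃ λ X → P X × x ∉ X
∃-member-∉ {P = P} P? x ¬all with anySubset? (λ X → P? X ×-dec ¬? (x ∈? X))
... | yes (X , PX , x∉X) = X , PX , x∉X
... | no ¬some = contradiction x∈member ¬all
  where
  x∈member : ∀ X → P X → x ∈ X
  x∈member X PX with x ∈? X
  ... | yes x∈X = x∈X
  ... | no  x∉X = contradiction (X , PX , x∉X) ¬some

firstMembers : ∀ {n} → ℕ → Subset n → Subset n
firstMembers t       []          = []
firstMembers zero    (_     ∷ s) = outside ∷ firstMembers zero s
firstMembers (suc t) (true  ∷ s) = inside  ∷ firstMembers t s
firstMembers (suc t) (false ∷ s) = outside ∷ firstMembers (suc t) s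

∣firstMembers∣ : ∀ {n} t (s : Subset n) → t ≤ ∣ s ∣ → ∣ firstMembers t s ∣ ≡ t
∣firstMembers∣ zero    []          _       = refl
∣firstMembers∣ zero    (_     ∷ s) _       = ∣firstMembers∣ zero s z≤n
∣firstMembers∣ (suc t) (true  ∷ s) (s≤s t≤) = cong suc (∣firstMembers∣ t s t≤)
∣firstMembers∣ (suc t) (false ∷ s) t≤      = ∣firstMembers∣ (suc t) s t≤

firstMembers⊆ : ∀ {n} t (s : Subset n) → firstMembers t s ⊆ s
firstMembers⊆ zero    (_     ∷ s) (there x∈) = there (firstMembers⊆ zero s x∈)
firstMembers⊆ (suc t) (true  ∷ s) here       = here
firstMembers⊆ (suc t) (true  ∷ s) (there x∈) = there (firstMembers⊆ t s x∈)
firstMembers⊆ (suc t) (false ∷ s) (there x∈) = there (firstMembers⊆ (suc t) s x∈)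

zero∈firstMembers : ∀ {n} t (s : Subset (suc n)) → 1 ≤ t → Fin.zero ∈ s → Fin.zero ∈ firstMembers t s
zero∈firstMembers (suc t) (true ∷ s) _ here = here

zero∈⇒Contains1 : ∀ {n} (Y : Subset (suc n)) → Fin.zero ∈ Y → Contains1 Y
zero∈⇒Contains1 (true ∷ Y) here = tt

⊆∁⇒∉member : ∀ {n} {B : Family n} → Intersecting B → ∀ {Z Y} → B Z → Y ⊆ ∁ Z → ¬ B Y
⊆∁⇒∉member intersecting {Z} {Y} BZ Y⊆∁Z BY with intersecting Z Y BZ BY
... | x , x∈Z∩Y with x∈p∩q⁻ Z Y x∈Z∩Y
... | x∈Z , x∈Y = x∈∁p⇒x∉p (Y⊆∁Z x∈Y) x∈Z

⊆∁-nonempty⇒proper : ∀ {n} {Z Y : Subset n} → Nonempty Z → Y ⊆ ∁ Z → ∃ λ x → x ∉ Y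
⊆∁-nonempty⇒proper (x , x∈Z) Y⊆∁Z = x , λ x∈Y → x∈∁p⇒x∉p (Y⊆∁Z x∈Y) x∈Z

member∌1⇒∃nonMemberOfU : ∀ {n} {B : Family (suc n)} → (∀ X → B X → InP X) → Intersecting B →
  ∀ {Z} → B Z → Fin.zero ∉ Z → ∀ t → 1 ≤ t → t ≤ ∣ ∁ Z ∣ →
  ∃ λ Y → InU Y × ¬ B Y × ∣ Y ∣ ≡ t
member∌1⇒∃nonMemberOfU {n} ⊆𝒫 intersecting {Z} BZ 1∉Z t 1≤t t≤∣∁Z∣ =
  Y , ((((Fin.zero , 1∈Y) , ⊆∁-nonempty⇒proper Z-nonempty Y⊆∁Z) , zero∈⇒Contains1 Y 1∈Y)
    , ⊆∁⇒∉member intersecting BZ Y⊆∁Z , ∣firstMembers∣ t (∁ Z) t≤∣∁Z∣)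
  where
  Y : Subset (suc n)
  Y = firstMembers t (∁ Z)
  Y⊆∁Z : Y ⊆ ∁ Z
  Y⊆∁Z = firstMembers⊆ t (∁ Z)
  1∈Y : Fin.zero ∈ Y
  1∈Y = zero∈firstMembers t (∁ Z) 1≤t (x∉p⇒x∈∁p 1∉Z)
  Z-nonempty : Nonempty Z
  Z-nonempty with ⊆𝒫 Z BZ
  ... | nonempty , _ = nonempty

lemma2p6 : (k n : ℕ) (m : ℕ∞) → 4 ≤ k → ValidM m → k + qOf k m ≤ n →
    (B : Family n) → Decidable B → MaximalIntersecting B →
    StarIntersectionEmpty (qOf k m) k B →
    ∃ λ (Y : Subset n) → InU Y × ¬ B Y × ∣ Y ∣ ≡ n ∸ k
lemma2p6 zero    _       _ ()
lemma2p6 (suc _) zero    _ _   _  ()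
lemma2p6 k       (suc n) m 4≤k vm k+q≤n B B? (⊆𝒫 , intersecting , _) ⋂⋆≡∅
  with ∃-member-∉ (λ X → B? X ×-dec ((qOf k m ≤? ∣ X ∣) ×-dec (∣ X ∣ ≤? k))) Fin.zero
                  (λ 1∈⋂⋆ → ⋂⋆≡∅ (Fin.zero , 1∈⋂⋆))
... | Z , (BZ , _ , ∣Z∣≤k) , 1∉Z =
  member∌1⇒∃nonMemberOfU ⊆𝒫 intersecting BZ 1∉Z (suc n ∸ k) (m<n⇒0<n∸m k<n) n∸k≤∣∁Z∣
  where
  k<n : k < suc n
  k<n = subst (_≤ suc n) (+-comm k 1) (≤-trans (+-monoʳ-≤ k (qOf-positive m (≤-trans (s≤s z≤n) 4≤k) vm)) k+q≤n)
  n∸k≤∣∁Z∣ : suc n ∸ k ≤ ∣ ∁ Z ∣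
  n∸k≤∣∁Z∣ = subst (suc n ∸ k ≤_) (sym (∣∁p∣≡n∸∣p∣ Z)) (∸-monoʳ-≤ (suc n) ∣Z∣≤k)
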